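{- For any integer $n\ge3$, the path $P_n$ of order $n$ satisfies $$\gamma_{(2,2,2)}(P_n)=2\gamma_t(P_n)=\begin{cases} n & \text{if } n\equiv 0\pmod 4,\\ n+1 & \text{if } n\equiv 1,3\pmod 4,\\ n+2 & \text{if } n\equiv 2\pmod 4.\end{cases}$$
   Context: $N(v)$ is the open neighbourhood and $f(S)=\sum_{u\in S}f(u)$. $\gamma_{(2,2,2)}(G)$ is the minimum of $\sum_v f(v)$ over functions $f:V(G)\to\{0,1,2\}$ with $f(N(v))\ge2$ for every vertex $v$. $\gamma_t(G)$ is the total domination number (minimum size of a set $D$ such that every vertex has a neighbour in $D$). -}

module Defs where

open import Data.Nat using (ℕ; zero; suc; _+_; _*_; _≤_; _%_)
open import Data.Nat.Properties using (_≟_)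
open import Data.Fin using (Fin; toℕ)
open import Data.Fin.Subset using (Subset; _∈_; ∣_∣)
open import Data.List using (List; map; allFin)
open import Data.Nat.ListAction using (sum)
open import Data.Product using (Σ; _×_; ∃; _,_)
open import Data.Sum using (_⊎_)
open import Relation.Nullary using (Dec; yes; no)
open import Relation.Nullary.Decidable using (_⊎-dec_)
open import Relation.Binary.PropositionalEquality using (_≡_)

record Graph (n : ℕ) : Set₁ where
  field
    Adj  : Fin n → Fin n → Set
    adj? : (u v : Fin n) → Dec (Adj u v)
open Graph public

PathAdj : {n : ℕ} → Fin n → Fin n → Set
PathAdj i j = (suc (toℕ i) ≡ toℕ j) ⊎ (suc (toℕ j) ≡ toℕ i)

Path : (n : ℕ) → Graph n
Path n = record
  { Adj  = PathAdj
  ; adj? = λ i j → (suc (toℕ i) ≟ toℕ j) ⊎-dec (suc (toℕ j) ≟ toℕ i) }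

Σv : {n : ℕ} → (Fin n → ℕ) → ℕ
Σv {n} g = sum (map g (allFin n))

weight : {n : ℕ} → (Fin n → Fin 3) → ℕ
weight f = Σv (λ u → toℕ (f u))

nbhdSum : {n : ℕ} → Graph n → (Fin n → Fin 3) → Fin n → ℕ
nbhdSum G f v = Σv (λ u → sum' (adj? G v u) (toℕ (f u)))
  where
    sum' : ∀ {P : Set} → Dec P → ℕ → ℕ
    sum' (yes _) k = k
    sum' (no _)  _ = 0

Is222Function : {n : ℕ} → Graph n → (Fin n → Fin 3) → Set
Is222Function G f = ∀ v → 2 ≤ nbhdSum G f v

IsGamma222 : {n : ℕ} → Graph n → ℕ → Set
IsGamma222 {n} G k =
  (Σ (Fin n → Fin 3) λ f → Is222Function G f × weight f ≡ k)
  × (∀ (f : Fin n → Fin 3) → Is222Function G f → k ≤ weight f)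

IsTDS : {n : ℕ} → Graph n → Subset n → Set
IsTDS {n} G D = ∀ v → Σ (Fin n) λ u → Adj G v u × u ∈ D

IsGammaT : {n : ℕ} → Graph n → ℕ → Set
IsGammaT {n} G k =
  (Σ (Subset n) λ D → IsTDS G D × ∣ D ∣ ≡ k)
  × (∀ (D : Subset n) → IsTDS G D → k ≤ ∣ D ∣)

pathValue : ℕ → ℕ
pathValue n with n % 4
... | 0 = n
... | 1 = n + 1
... | 2 = n + 2
... | _ = n + 1

-- A (2,2,2)-function f on P_n must satisfy f(i-1) + f(i+1) ≥ 2 at every vertex i, a constraint
-- between two positions of equal parity. Splitting the padded sequence 0, f(0), …, f(n-1), 0 into
-- its even and its odd positions yields two sequences whose consecutive terms sum to at least 2,
-- so each has sum at least twice its number of disjoint consecutive pairs; altogether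
-- weight f ≥ 2 (⌈⌈n/2⌉/2⌉ + ⌈⌊n/2⌋/2⌉). Doubling the indicator of a total dominating set gives a
-- (2,2,2)-function, and the pattern 0110 0110 … closed by a block of length 2 to 5 is a total
-- dominating set of exactly half that size, so both bounds are attained.
module Submission where

open import Defs
open import Data.Bool using (true; false; if_then_else_)
open import Data.Empty using (⊥-elim)
open import Data.Fin using (Fin; zero; suc; toℕ; fromℕ<)
open import Data.Fin.Properties using (all?; any?; toℕ-fromℕ<)
open import Data.Fin.Subset using (Subset; _∈_; ∣_∣)
open import Data.Fin.Subset.Properties using (_∈?_)
open import Data.List using (tabulate)
open import Data.List.Properties using (map-tabulate)
import Data.Nat.ListAction as List
open import Data.Nat using (ℕ; zero; suc; _+_; _*_; _≤_; _<_; z≤n; s≤s; _%_; ⌈_/2⌉; ⌊_/2⌋)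
open import Data.Nat.Properties
open import Algebra.Properties.CommutativeMonoid.Sum +-0-commutativeMonoid
  using (sum-syntax; sum-cong-≗; sum-remove; sum-replicate-zero; ∑-distrib-+)
open import Data.Nat.Tactic.RingSolver using (solve-∀)
open import Data.Product using (Σ; _×_; _,_; proj₁)
open import Data.Sum using (inj₁; inj₂)
open import Data.Vec using ([]; _∷_; lookup; here; there)
open import Data.Vec.Properties using ([]=⇒lookup)
open import Function using (_∘_)
open import Relation.Nullary using (Dec; yes; no; does; ¬_)
open import Relation.Nullary.Decidable using (_×-dec_; _⊎-dec_; True; toWitness)
open import Relation.Binary.PropositionalEquality

Σv≡∑ : ∀ {n} (g : Fin n → ℕ) → Σv g ≡ ∑[ u < n ] g u
Σv≡∑ {n} g = trans (cong List.sum (map-tabulate (λ u → u) g)) (tabulate-sum g)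
  where
  tabulate-sum : ∀ {m} (h : Fin m → ℕ) → List.sum (tabulate h) ≡ ∑[ u < m ] h u
  tabulate-sum {zero} h = refl
  tabulate-sum {suc m} h = cong (h zero +_) (tabulate-sum (h ∘ suc))

term≤∑ : ∀ {n} (g : Fin n → ℕ) (u : Fin n) → g u ≤ ∑[ w < n ] g w
term≤∑ {suc n} g u = ≤-trans (m≤m+n (g u) _) (≤-reflexive (sym (sum-remove {i = u} g)))

ifDec : {P : Set} → Dec P → ℕ → ℕ
ifDec d k = if does d then k else 0

-- The summand of nbhdSum is local to Defs; unification recovers it.
private
  nbhdSummand : ∀ {n} → Graph n → (Fin n → Fin 3) → Fin n → Fin n → ℕ
  nbhdSummand {n} G f v = proj₁ unfolded
    where
    unfolded : Σ (Fin n → ℕ) λ g → nbhdSum G f v ≡ Σv g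
    unfolded = _ , refl

  nbhdSummand≡ifDec : ∀ {n} (G : Graph n) (f : Fin n → Fin 3) (v u : Fin n) →
    nbhdSummand G f v u ≡ ifDec (adj? G v u) (toℕ (f u))
  nbhdSummand≡ifDec G f v u with adj? G v u
  ... | yes _ = refl
  ... | no _ = refl

nbhdSum≡∑ : ∀ {n} (G : Graph n) (f : Fin n → Fin 3) (v : Fin n) →
  nbhdSum G f v ≡ ∑[ u < n ] ifDec (adj? G v u) (toℕ (f u))
nbhdSum≡∑ G f v = trans (Σv≡∑ (nbhdSummand G f v)) (sum-cong-≗ (nbhdSummand≡ifDec G f v))

neighbour≤nbhdSum : ∀ {n} (G : Graph n) (f : Fin n → Fin 3) {v u : Fin n} →
  Adj G v u → toℕ (f u) ≤ nbhdSum G f v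
neighbour≤nbhdSum G f {v} {u} vu = begin
  toℕ (f u)                          ≡⟨ selected (adj? G v u) ⟨
  ifDec (adj? G v u) (toℕ (f u))     ≤⟨ term≤∑ (λ w → ifDec (adj? G v w) (toℕ (f w))) u ⟩
  ∑[ w < _ ] ifDec (adj? G v w) (toℕ (f w)) ≡⟨ nbhdSum≡∑ G f v ⟨
  nbhdSum G f v                      ∎
  where
  open ≤-Reasoning
  selected : (d : Dec (Adj G v u)) → ifDec d (toℕ (f u)) ≡ toℕ (f u)
  selected (yes _) = refl
  selected (no ¬vu) = ⊥-elim (¬vu vu)

toSeq : ∀ {n} → (Fin n → ℕ) → ℕ → ℕ
toSeq {zero} h i = 0
toSeq {suc n} h zero = h zero
toSeq {suc n} h (suc i) = toSeq (h ∘ suc) i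

-- Position i + 1 holds h i, so that in P_n the neighbours of vertex i sit at positions i and i + 2.
padded : ∀ {n} → (Fin n → ℕ) → ℕ → ℕ
padded h zero = 0
padded h (suc i) = toSeq h i

∑-indicator-at : ∀ {n} (h : Fin n → ℕ) c → ∑[ u < n ] ifDec (c ≟ toℕ u) (h u) ≡ toSeq h c
∑-indicator-at {zero} h c = refl
∑-indicator-at {suc n} h zero = trans (cong (h zero +_) (sum-replicate-zero n)) (+-identityʳ _)
∑-indicator-at {suc n} h (suc c) = ∑-indicator-at (h ∘ suc) c

∑-indicator-before : ∀ {n} (h : Fin n → ℕ) c → ∑[ u < n ] ifDec (suc (toℕ u) ≟ c) (h u) ≡ padded h c
∑-indicator-before {n} h zero = sum-replicate-zero n
∑-indicator-before {zero} h (suc c) = refl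
∑-indicator-before {suc n} h (suc zero) = trans (cong (h zero +_) (sum-replicate-zero n)) (+-identityʳ _)
∑-indicator-before {suc n} h (suc (suc c)) = ∑-indicator-before (h ∘ suc) (suc c)

ifDec-⊎ : {A B : Set} → ¬ (A × B) → (a : Dec A) (b : Dec B) (k : ℕ) →
  ifDec (a ⊎-dec b) k ≡ ifDec a k + ifDec b k
ifDec-⊎ ¬ab (yes a) (yes b) k = ⊥-elim (¬ab (a , b))
ifDec-⊎ ¬ab (yes _) (no _) k = sym (+-identityʳ k)
ifDec-⊎ ¬ab (no _) (yes _) k = refl
ifDec-⊎ ¬ab (no _) (no _) k = refl

nbhdSum-Path : ∀ {n} (f : Fin n → Fin 3) (v : Fin n) →
  nbhdSum (Path n) f v ≡ padded (toℕ ∘ f) (toℕ v) + padded (toℕ ∘ f) (2 + toℕ v)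
nbhdSum-Path {n} f v = begin
  nbhdSum (Path n) f v
    ≡⟨ nbhdSum≡∑ (Path n) f v ⟩
  ∑[ u < n ] ifDec (adj? (Path n) v u) (h u)
    ≡⟨ sum-cong-≗ (λ u → ifDec-⊎ (not-both (toℕ v) (toℕ u)) (after u) (before u) (h u)) ⟩
  ∑[ u < n ] (ifDec (after u) (h u) + ifDec (before u) (h u))
    ≡⟨ ∑-distrib-+ (λ u → ifDec (after u) (h u)) (λ u → ifDec (before u) (h u)) ⟩
  ∑[ u < n ] ifDec (after u) (h u) + ∑[ u < n ] ifDec (before u) (h u)
    ≡⟨ cong₂ _+_ (∑-indicator-at h (suc (toℕ v))) (∑-indicator-before h (toℕ v)) ⟩
  toSeq h (suc (toℕ v)) + padded h (toℕ v)
    ≡⟨ +-comm (toSeq h (suc (toℕ v))) (padded h (toℕ v)) ⟩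
  padded h (toℕ v) + padded h (2 + toℕ v) ∎
  where
  open ≡-Reasoning
  h : Fin n → ℕ
  h = toℕ ∘ f
  after : (u : Fin n) → Dec (suc (toℕ v) ≡ toℕ u)
  after u = suc (toℕ v) ≟ toℕ u
  before : (u : Fin n) → Dec (suc (toℕ u) ≡ toℕ v)
  before u = suc (toℕ u) ≟ toℕ v
  not-both : ∀ i j → ¬ (suc i ≡ j × suc j ≡ i)
  not-both i j (ij , ji) = m≢1+n+m j (sym (trans (cong suc ji) ij))

PairSums≥2 : (gap m : ℕ) → (ℕ → ℕ) → Set
PairSums≥2 gap m x = ∀ i → i < m → 2 ≤ x i + x (gap + i)

evens : (ℕ → ℕ) → ℕ → ℕ
evens x zero = x 0
evens x (suc k) = evens (λ i → x (2 + i)) k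

odds : (ℕ → ℕ) → ℕ → ℕ
odds x = evens (λ i → x (suc i))

∑-evens-odds : ∀ N (x : ℕ → ℕ) →
  ∑[ i < N ] x (toℕ i) ≡ ∑[ k < ⌈ N /2⌉ ] evens x (toℕ k) + ∑[ k < ⌊ N /2⌋ ] odds x (toℕ k)
∑-evens-odds zero x = refl
∑-evens-odds (suc zero) x = sym (+-identityʳ _)
∑-evens-odds (suc (suc N)) x =
  trans (cong (λ s → x 0 + (x 1 + s)) (∑-evens-odds N (λ i → x (2 + i)))) (interchange (x 0) (x 1) _ _)
  where
  interchange : ∀ a b c d → a + (b + (c + d)) ≡ (a + c) + (b + d)
  interchange = solve-∀

adjacentPairs-sum : ∀ m (x : ℕ → ℕ) → PairSums≥2 1 m x → ⌈ m /2⌉ * 2 ≤ ∑[ k < suc m ] x (toℕ k)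
adjacentPairs-sum zero x _ = z≤n
adjacentPairs-sum (suc zero) x pairs =
  ≤-trans (pairs 0 (s≤s z≤n)) (≤-reflexive (cong (x 0 +_) (sym (+-identityʳ (x 1)))))
adjacentPairs-sum (suc (suc m)) x pairs =
  ≤-trans (+-mono-≤ (pairs 0 (s≤s z≤n)) (adjacentPairs-sum m (λ i → x (2 + i)) shiftedPairs))
          (≤-reflexive (+-assoc (x 0) (x 1) _))
  where
  shiftedPairs : PairSums≥2 1 m (λ i → x (2 + i))
  shiftedPairs i i<m = pairs (2 + i) (s≤s (s≤s i<m))

evens-pairs : ∀ n (x : ℕ → ℕ) → PairSums≥2 2 n x → PairSums≥2 1 ⌈ n /2⌉ (evens x)
evens-pairs (suc n) x pairs zero _ = pairs 0 (s≤s z≤n)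
evens-pairs (suc (suc n)) x pairs (suc k) (s≤s k<) =
  evens-pairs n (λ i → x (2 + i)) (λ i i<n → pairs (2 + i) (s≤s (s≤s i<n))) k k<

odds-pairs : ∀ n (x : ℕ → ℕ) → PairSums≥2 2 n x → PairSums≥2 1 ⌊ n /2⌋ (odds x)
odds-pairs (suc n) x pairs = evens-pairs n (λ i → x (suc i)) (λ i i<n → pairs (suc i) (s≤s i<n))

tdPath : ℕ → ℕ
tdPath n = ⌈ ⌈ n /2⌉ /2⌉ + ⌈ ⌊ n /2⌋ /2⌉

gapTwoPairs-sum : ∀ n (x : ℕ → ℕ) → PairSums≥2 2 n x → 2 * tdPath n ≤ ∑[ i < 2 + n ] x (toℕ i)
gapTwoPairs-sum n x pairs = begin
  2 * tdPath n
    ≡⟨ *-comm 2 (tdPath n) ⟩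
  tdPath n * 2
    ≡⟨ *-distribʳ-+ 2 ⌈ ⌈ n /2⌉ /2⌉ ⌈ ⌊ n /2⌋ /2⌉ ⟩
  ⌈ ⌈ n /2⌉ /2⌉ * 2 + ⌈ ⌊ n /2⌋ /2⌉ * 2
    ≤⟨ +-mono-≤ (adjacentPairs-sum ⌈ n /2⌉ (evens x) (evens-pairs n x pairs))
                (adjacentPairs-sum ⌊ n /2⌋ (odds x) (odds-pairs n x pairs)) ⟩
  ∑[ k < suc ⌈ n /2⌉ ] evens x (toℕ k) + ∑[ k < suc ⌊ n /2⌋ ] odds x (toℕ k)
    ≡⟨ ∑-evens-odds (2 + n) x ⟨
  ∑[ i < 2 + n ] x (toℕ i) ∎
  where open ≤-Reasoning

∑-toSeq : ∀ {n} N (h : Fin n → ℕ) → n ≤ N → ∑[ i < N ] toSeq h (toℕ i) ≡ ∑[ u < n ] h u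
∑-toSeq {zero} N h _ = sum-replicate-zero N
∑-toSeq {suc n} (suc N) h (s≤s n≤N) = cong (h zero +_) (∑-toSeq N (h ∘ suc) n≤N)

weight≡∑padded : ∀ {n} (f : Fin n → Fin 3) → weight f ≡ ∑[ i < 2 + n ] padded (toℕ ∘ f) (toℕ i)
weight≡∑padded {n} f = trans (Σv≡∑ (toℕ ∘ f)) (sym (∑-toSeq (suc n) (toℕ ∘ f) (n≤1+n n)))

is222-Path⇒pairSums : ∀ {n} (f : Fin n → Fin 3) → Is222Function (Path n) f →
  PairSums≥2 2 n (padded (toℕ ∘ f))
is222-Path⇒pairSums f is222 i i<n =
  subst (λ j → 2 ≤ padded (toℕ ∘ f) j + padded (toℕ ∘ f) (2 + j)) (toℕ-fromℕ< i<n)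
        (≤-trans (is222 (fromℕ< i<n)) (≤-reflexive (nbhdSum-Path f (fromℕ< i<n))))

weight≥-Path : ∀ {n} (f : Fin n → Fin 3) → Is222Function (Path n) f → 2 * tdPath n ≤ weight f
weight≥-Path {n} f is222 =
  subst (2 * tdPath n ≤_) (sym (weight≡∑padded f))
        (gapTwoPairs-sum n (padded (toℕ ∘ f)) (is222-Path⇒pairSums f is222))

twice : ∀ {n} → Subset n → Fin n → Fin 3
twice D u = if lookup D u then suc (suc zero) else zero

weight-twice : ∀ {n} (D : Subset n) → weight (twice D) ≡ 2 * ∣ D ∣
weight-twice D = trans (Σv≡∑ (toℕ ∘ twice D)) (∑-twice D)
  where
  ∑-twice : ∀ {n} (D : Subset n) → ∑[ u < n ] toℕ (twice D u) ≡ 2 * ∣ D ∣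
  ∑-twice [] = refl
  ∑-twice (true ∷ D) = trans (cong (2 +_) (∑-twice D)) (sym (*-suc 2 ∣ D ∣))
  ∑-twice (false ∷ D) = ∑-twice D

twice-∈ : ∀ {n} {D : Subset n} {u : Fin n} → u ∈ D → toℕ (twice D u) ≡ 2
twice-∈ u∈D rewrite []=⇒lookup u∈D = refl

isTDS⇒is222-twice : ∀ {n} (G : Graph n) {D : Subset n} → IsTDS G D → Is222Function G (twice D)
isTDS⇒is222-twice G {D} tds v with tds v
... | u , vu , u∈D = subst (_≤ nbhdSum G (twice D) v) (twice-∈ u∈D) (neighbour≤nbhdSum G (twice D) vu)

isTDS? : ∀ {n} (G : Graph n) (D : Subset n) → Dec (IsTDS G D)
isTDS? G D = all? λ v → any? λ u → adj? G v u ×-dec (u ∈? D)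

PathAdj-suc : ∀ {n} {i j : Fin n} → PathAdj i j → PathAdj {suc n} (suc i) (suc j)
PathAdj-suc (inj₁ ij) = inj₁ (cong suc ij)
PathAdj-suc (inj₂ ji) = inj₂ (cong suc ji)

isTDS-0110∷ : ∀ {n} {D : Subset n} → IsTDS (Path n) D →
  IsTDS (Path (4 + n)) (false ∷ true ∷ true ∷ false ∷ D)
isTDS-0110∷ tds zero = suc zero , inj₁ refl , there here
isTDS-0110∷ tds (suc zero) = suc (suc zero) , inj₁ refl , there (there here)
isTDS-0110∷ tds (suc (suc zero)) = suc zero , inj₂ refl , there here
isTDS-0110∷ tds (suc (suc (suc zero))) = suc (suc zero) , inj₂ refl , there (there here)
isTDS-0110∷ tds (suc (suc (suc (suc v)))) with tds v
... | u , vu , u∈D =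
  suc (suc (suc (suc u))) , PathAdj-suc (PathAdj-suc (PathAdj-suc (PathAdj-suc vu))) ,
  there (there (there (there u∈D)))

tdPath-4+ : ∀ n → tdPath (4 + n) ≡ 2 + tdPath n
tdPath-4+ n = cong suc (+-suc ⌈ ⌈ n /2⌉ /2⌉ ⌈ ⌊ n /2⌋ /2⌉)

PathTDS : ℕ → Set
PathTDS n = Σ (Subset n) λ D → IsTDS (Path n) D × ∣ D ∣ ≡ tdPath n

decidedPathTDS : ∀ {n} (D : Subset n) → True (isTDS? (Path n) D) → ∣ D ∣ ≡ tdPath n → PathTDS n
decidedPathTDS D isYes size = D , toWitness isYes , size

pathTDS : ∀ n → 2 ≤ n → PathTDS n
pathTDS 1 (s≤s ())
pathTDS 2 _ = decidedPathTDS (true ∷ true ∷ []) _ refl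
pathTDS 3 _ = decidedPathTDS (false ∷ true ∷ true ∷ []) _ refl
pathTDS 4 _ = decidedPathTDS (false ∷ true ∷ true ∷ false ∷ []) _ refl
pathTDS 5 _ = decidedPathTDS (false ∷ true ∷ true ∷ true ∷ false ∷ []) _ refl
pathTDS (suc (suc (suc (suc (suc (suc n)))))) _ with pathTDS (2 + n) (s≤s (s≤s z≤n))
... | D , tds , size = false ∷ true ∷ true ∷ false ∷ D , isTDS-0110∷ tds ,
                       trans (cong (2 +_) size) (sym (tdPath-4+ (2 + n)))

pathValue-4+ : ∀ n → pathValue (4 + n) ≡ 4 + pathValue n
pathValue-4+ n with n % 4
... | 0 = refl
... | 1 = refl
... | 2 = refl
... | suc (suc (suc _)) = refl

pathValue≡2*tdPath : ∀ n → pathValue n ≡ 2 * tdPath n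
pathValue≡2*tdPath 0 = refl
pathValue≡2*tdPath 1 = refl
pathValue≡2*tdPath 2 = refl
pathValue≡2*tdPath 3 = refl
pathValue≡2*tdPath (suc (suc (suc (suc n)))) = begin
  pathValue (4 + n)    ≡⟨ pathValue-4+ n ⟩
  4 + pathValue n      ≡⟨ cong (4 +_) (pathValue≡2*tdPath n) ⟩
  4 + 2 * tdPath n     ≡⟨ *-distribˡ-+ 2 2 (tdPath n) ⟨
  2 * (2 + tdPath n)   ≡⟨ cong (2 *_) (tdPath-4+ n) ⟨
  2 * tdPath (4 + n)   ∎
  where open ≡-Reasoning

proposition3p19 : (n : ℕ) → 3 ≤ n →
    Σ ℕ λ g222 → Σ ℕ λ gt →
      IsGamma222 (Path n) g222 × IsGammaT (Path n) gt
      × g222 ≡ 2 * gt × g222 ≡ pathValue n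
proposition3p19 n 3≤n with pathTDS n (≤-trans (n≤1+n 2) 3≤n)
... | D , tds , size = 2 * tdPath n , tdPath n , γ222 , γt , refl , sym (pathValue≡2*tdPath n)
  where
  γ222 : IsGamma222 (Path n) (2 * tdPath n)
  γ222 = (twice D , isTDS⇒is222-twice (Path n) tds , trans (weight-twice D) (cong (2 *_) size))
       , weight≥-Path
  γt : IsGammaT (Path n) (tdPath n)
  γt = (D , tds , size)
     , λ D′ tds′ → *-cancelˡ-≤ 2 (subst (2 * tdPath n ≤_) (weight-twice D′)
                                        (weight≥-Path (twice D′) (isTDS⇒is222-twice (Path n) tds′)))
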